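{- There is a constant $C$ such that for every integer $d$ divisible by $4$, every $1$-cover of $\mathtt{Disj}_{d/4,d/4,d}$ has sparsity at least $2^d/\left(d^{C}\binom{d}{d/4}\right)$.
   Context: The disjointness matrix $\mathtt{Disj}_{p,q,d}$ has rows indexed by $\binom{[d]}{p}$, columns indexed by $\binom{[d]}{q}$, and entry $1$ at $(A,B)$ if $A\cap B=\emptyset$ and $0$ otherwise. A monochromatic rectangle is a pair $(X,Y)$ of a set of rows and a set of columns on which all entries are equal. A family $(X_1,Y_1),\ldots,(X_z,Y_z)$ of monochromatic rectangles is a $1$-cover if every $1$-entry lies in some $X_k\times Y_k$. The sparsity of a $1$-cover of an $n\times m$ matrix is $\sum_i|X_i|/n+\sum_i|Y_i|/m$. -}

module Defs where

open import Data.Nat using (ℕ; _+_)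
open import Data.Fin.Subset using (Subset; _∩_; ⊥; ∣_∣)
open import Data.List using (List; length; map)
open import Data.Nat.ListAction using (sum)
open import Data.List.Membership.Propositional using (_∈_)
open import Data.List.Relation.Unary.All using (All)
open import Data.List.Relation.Unary.Any using (Any)
open import Data.List.Relation.Unary.Unique.Propositional using (Unique)
open import Data.Product using (_×_; _,_; proj₁; proj₂; Σ)
open import Data.Sum using (_⊎_)
open import Relation.Binary.PropositionalEquality using (_≡_; _≢_)

-- Rows/columns of Disj_{p,q,d} are the p-subsets / q-subsets of [d] = Fin d,
-- represented as 'Subset d' (characteristic vectors) of cardinality p resp. q.

DisjOne : {d : ℕ} → Subset d → Subset d → Set
DisjOne A B = A ∩ B ≡ ⊥

RowSet : (d p : ℕ) → Set
RowSet d p = Σ (List (Subset d)) λ X → Unique X × All (λ A → ∣ A ∣ ≡ p) X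

Rect : (d p q : ℕ) → Set
Rect d p q = RowSet d p × RowSet d q

rows : ∀ {d p q} → Rect d p q → List (Subset d)
rows R = proj₁ (proj₁ R)

cols : ∀ {d p q} → Rect d p q → List (Subset d)
cols R = proj₁ (proj₂ R)

Monochromatic : ∀ {d p q} → Rect d p q → Set
Monochromatic R =
  (∀ {A B} → A ∈ rows R → B ∈ cols R → DisjOne A B) ⊎
  (∀ {A B} → A ∈ rows R → B ∈ cols R → A ∩ B ≢ ⊥)

IsOneCover : (d p q : ℕ) → List (Rect d p q) → Set
IsOneCover d p q Rs =
  All Monochromatic Rs ×
  (∀ (A B : Subset d) → ∣ A ∣ ≡ p → ∣ B ∣ ≡ q → DisjOne A B →
     Any (λ R → A ∈ rows R × B ∈ cols R) Rs)

-- Σ_i |X_i| + Σ_i |Y_i|.  For Disj_{k,k,d} (n = m = binom d k) the sparsity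
-- of the cover is exactly  totalSize Rs / binom d k.
totalSize : ∀ {d p q} → List (Rect d p q) → ℕ
totalSize Rs = sum (map (λ R → length (rows R)) Rs) + sum (map (λ R → length (cols R)) Rs)

-- A 1-rectangle X × Y has ⋃X ∩ ⋃Y = ∅, so if d ≤ 2n one of the two unions has at most n
-- points and the corresponding side consists of at most C(n,k) k-subsets of it; hence
-- |X||Y| ≤ C(n,k)(|X| + |Y|).  Summing over the 1-rectangles of a cover, the number
-- C(d,2k)C(2k,k) of 1-entries of Disj_{k,k,d} is at most C(n,k) times the total size.
-- For d = 4k and n = 2k the factors C(2k,k) cancel, and 2^d ≤ d C(d,d/2) leaves the bound
-- with C = 1.

module Submission where

open import Data.Nat
  using (ℕ; zero; suc; _+_; _*_; _∸_; _^_; _≤_; _<_; z≤n; s≤s; _≤′_; ≤′-refl; ≤′-step; NonZero; >-nonZero)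
open import Data.Nat.Properties
open import Data.Nat.Combinatorics using (_C_; nCk+nC[k+1]≡[n+1]C[k+1]; nCk≡nC[n∸k]; nC1≡n; nCn≡1; k>n⇒nCk≡0)
open import Data.Nat.ListAction using (sum)
open import Data.Nat.Tactic.RingSolver using (solve-∀)
open import Data.Bool using (Bool; true; false)
open import Data.Vec using ([]; _∷_)
import Data.Vec as Vec
open import Data.Fin.Subset
  using (Subset; _∩_; _∪_; ∁; ⋃; ∣_∣; ⊥) renaming (_⊆_ to _⊆ˢ_; _∈_ to _∈ˢ_)
open import Data.Fin.Subset.Properties
  using (drop-∷-⊆; p⊆p∪q; q⊆p∪q; ⊆-trans; x∈p∩q⁺; ∉⊥; x∉p⇒x∈∁p; ∣∁p∣≡n∸∣p∣; p⊆q⇒∣p∣≤∣q∣;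
         ∣p∣≤n; ∩-distribʳ-∪; ∩-comm; ∩-zeroˡ; ∪-identityˡ)
open import Data.List using (List; []; _∷_; length; map; _++_; cartesianProduct)
open import Data.List.Properties using (length-++; length-map; length-++-sucʳ)
open import Data.List.Membership.Propositional using (_∈_)
open import Data.List.Membership.Propositional.Properties
  using (∈-∃++; ∈-++⁻; ∈-++⁺ˡ; ∈-++⁺ʳ; ∈-map⁺; ∈-map⁻; ∈-cartesianProduct⁺)
open import Data.List.Relation.Binary.Subset.Propositional using (_⊆_)
open import Data.List.Relation.Binary.Disjoint.Propositional using (Disjoint)
open import Data.List.Relation.Unary.Any using (Any; here; there)
open import Data.List.Relation.Unary.All as All using (All; []; _∷_)
open import Data.List.Relation.Unary.AllPairs using ([]; _∷_)
open import Data.List.Relation.Unary.Unique.Propositional using (Unique)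
open import Data.List.Relation.Unary.Unique.Propositional.Properties using (++⁺; map⁺)
open import Data.Product using (Σ; _×_; _,_; proj₁)
open import Data.Sum using (_⊎_; inj₁; inj₂)
import Data.Sum as Sum
open import Function using (_∘_)
open import Relation.Binary.PropositionalEquality
open import Relation.Nullary using (contradiction)

open import Defs

m+n≤o+o⇒m≤o⊎n≤o : ∀ {m n o} → m + n ≤ o + o → m ≤ o ⊎ n ≤ o
m+n≤o+o⇒m≤o⊎n≤o {m} {n} {o} m+n≤o+o with ≤-total m o
... | inj₁ m≤o = inj₁ m≤o
... | inj₂ o≤m = inj₂ (+-cancelˡ-≤ o n o (≤-trans (+-monoˡ-≤ n o≤m) m+n≤o+o))

m≤o⊎n≤o⇒m*n≤o*[m+n] : ∀ {m n o} → m ≤ o ⊎ n ≤ o → m * n ≤ o * (m + n)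
m≤o⊎n≤o⇒m*n≤o*[m+n] {m} {n} {o} (inj₁ m≤o) = ≤-trans (*-monoˡ-≤ n m≤o) (*-monoʳ-≤ o (m≤n+m n m))
m≤o⊎n≤o⇒m*n≤o*[m+n] {m} {n} {o} (inj₂ n≤o) =
  ≤-trans (≤-trans (*-monoʳ-≤ m n≤o) (≤-reflexive (*-comm m o))) (*-monoʳ-≤ o (m≤m+n m n))

pascal : ∀ n k → n C suc k + n C k ≡ suc n C suc k
pascal n k = trans (+-comm (n C suc k) (n C k)) (nCk+nC[k+1]≡[n+1]C[k+1] n k)

C-absorption : ∀ n k → suc k * (suc n C suc k) ≡ suc n * (n C k)
C-absorption zero zero = refl
C-absorption zero (suc k) =
  trans (cong (suc (suc k) *_) (k>n⇒nCk≡0 {1} {suc (suc k)} (s≤s (s≤s z≤n)))) (*-zeroʳ (suc (suc k)))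
C-absorption (suc n) zero = trans (+-identityʳ _) (trans (nC1≡n (suc (suc n))) (sym (*-identityʳ _)))
C-absorption (suc n) (suc k) = begin
  suc (suc k) * (suc (suc n) C suc (suc k))
    ≡⟨ cong (suc (suc k) *_) (sym (nCk+nC[k+1]≡[n+1]C[k+1] (suc n) (suc k))) ⟩
  suc (suc k) * (suc n C suc k + suc n C suc (suc k))
    ≡⟨ rearrange (suc n C suc k) (suc n C suc (suc k)) k ⟩
  suc n C suc k + suc k * (suc n C suc k) + suc (suc k) * (suc n C suc (suc k))
    ≡⟨ cong₂ (λ x y → suc n C suc k + x + y) (C-absorption n k) (C-absorption n (suc k)) ⟩
  suc n C suc k + suc n * (n C k) + suc n * (n C suc k)
    ≡⟨ trans (+-assoc (suc n C suc k) _ _) (cong (suc n C suc k +_) (sym (*-distribˡ-+ (suc n) (n C k) _))) ⟩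
  suc n C suc k + suc n * (n C k + n C suc k)
    ≡⟨ cong (λ x → suc n C suc k + suc n * x) (nCk+nC[k+1]≡[n+1]C[k+1] n k) ⟩
  suc (suc n) * (suc n C suc k)
    ∎
  where
  open ≡-Reasoning
  rearrange : ∀ a b k → (2 + k) * (a + b) ≡ a + (1 + k) * a + (2 + k) * b
  rearrange = solve-∀

C-suc-≤ : ∀ n k → n C k ≤ suc n C k
C-suc-≤ n zero = ≤-refl
C-suc-≤ n (suc k) = ≤-trans (m≤n+m (n C suc k) (n C k)) (≤-reflexive (nCk+nC[k+1]≡[n+1]C[k+1] n k))

C-monoˡ-≤ : ∀ {m n} k → m ≤ n → m C k ≤ n C k
C-monoˡ-≤ k m≤n = go (≤⇒≤′ m≤n)
  where
  go : ∀ {m n} → m ≤′ n → m C k ≤ n C k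
  go ≤′-refl = ≤-refl
  go (≤′-step {n} m≤′n) = ≤-trans (go m≤′n) (C-suc-≤ n k)

0<C : ∀ {n k} → k ≤ n → 0 < n C k
0<C {n} {zero} _ = s≤s z≤n
0<C {suc n} {suc k} (s≤s k≤n) =
  ≤-trans (0<C k≤n) (≤-trans (m≤m+n (n C k) (n C suc k)) (≤-reflexive (nCk+nC[k+1]≡[n+1]C[k+1] n k)))

central-C-step : ∀ m → suc m * ((suc m + suc m) C suc m) ≡ 2 * (suc (m + m) * ((m + m) C m))
central-C-step m = begin
  suc m * ((suc m + suc m) C suc m)
    ≡⟨ cong (λ x → suc m * (suc x C suc m)) (+-suc m m) ⟩
  suc m * (suc (suc (m + m)) C suc m)
    ≡⟨ cong (suc m *_) (sym (nCk+nC[k+1]≡[n+1]C[k+1] (suc (m + m)) m)) ⟩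
  suc m * (suc (m + m) C m + suc (m + m) C suc m)
    ≡⟨ cong (λ x → suc m * (x + suc (m + m) C suc m)) middle-symmetric ⟩
  suc m * (suc (m + m) C suc m + suc (m + m) C suc m)
    ≡⟨ double (suc m) (suc (m + m) C suc m) ⟩
  2 * (suc m * (suc (m + m) C suc m))
    ≡⟨ cong (2 *_) (C-absorption (m + m) m) ⟩
  2 * (suc (m + m) * ((m + m) C m))
    ∎
  where
  open ≡-Reasoning
  double : ∀ a b → a * (b + b) ≡ 2 * (a * b)
  double = solve-∀
  middle-symmetric : suc (m + m) C m ≡ suc (m + m) C suc m
  middle-symmetric =
    trans (nCk≡nC[n∸k] (m≤n⇒m≤1+n (m≤m+n m m))) (cong (suc (m + m) C_) (m+n∸n≡m (suc m) m))

central-C-bound : ∀ m → 2 ^ (suc m + suc m) ≤ (suc m + suc m) * ((suc m + suc m) C suc m)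
central-C-bound zero = ≤-refl
central-C-bound (suc m) = begin
  2 ^ (suc (suc m) + suc (suc m))  ≡⟨ cong (λ x → 2 ^ suc x) (+-suc (suc m) (suc m)) ⟩
  2 * (2 * 2 ^ n)                  ≡⟨ sym (*-assoc 2 2 (2 ^ n)) ⟩
  4 * 2 ^ n                        ≤⟨ *-monoʳ-≤ 4 (central-C-bound m) ⟩
  4 * (n * c)                      ≤⟨ *-monoʳ-≤ 4 (*-monoˡ-≤ c (n≤1+n n)) ⟩
  4 * (suc n * c)                  ≡⟨ *-assoc 2 2 (suc n * c) ⟩
  2 * (2 * (suc n * c))            ≡⟨ cong (2 *_) (sym (central-C-step (suc m))) ⟩
  2 * (suc (suc m) * c′)           ≡⟨ sym (double (suc (suc m)) c′) ⟩
  (suc (suc m) + suc (suc m)) * c′ ∎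
  where
  open ≤-Reasoning
  n = suc m + suc m
  c = n C suc m
  c′ = (suc (suc m) + suc (suc m)) C suc (suc m)
  double : ∀ a b → (a + a) * b ≡ 2 * (a * b)
  double = solve-∀

Unique-⊆⇒length≤ : ∀ {a} {A : Set a} {xs ys : List A} → Unique xs → xs ⊆ ys → length xs ≤ length ys
Unique-⊆⇒length≤ {xs = []} _ _ = z≤n
Unique-⊆⇒length≤ {xs = x ∷ xs} (x∉xs ∷ !xs) xs⊆ys with ∈-∃++ (xs⊆ys (here refl))
... | us , vs , refl = subst (suc (length xs) ≤_) (sym (length-++-sucʳ us x vs))
  (s≤s (Unique-⊆⇒length≤ !xs xs⊆us++vs))
  where
  xs⊆us++vs : xs ⊆ us ++ vs
  xs⊆us++vs {y} y∈xs with ∈-++⁻ us (xs⊆ys (there y∈xs))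
  ... | inj₁ y∈us = ∈-++⁺ˡ y∈us
  ... | inj₂ (here y≡x) = contradiction (sym y≡x) (All.lookup x∉xs y∈xs)
  ... | inj₂ (there y∈vs) = ∈-++⁺ʳ us y∈vs

length-cartesianProduct : ∀ {a b} {A : Set a} {B : Set b} (xs : List A) (ys : List B) →
  length (cartesianProduct xs ys) ≡ length xs * length ys
length-cartesianProduct [] ys = refl
length-cartesianProduct (x ∷ xs) ys =
  trans (length-++ (map (x ,_) ys)) (cong₂ _+_ (length-map (x ,_) ys) (length-cartesianProduct xs ys))

subsetsOfSize : ∀ {n} → Subset n → ℕ → List (Subset n)
subsetsOfSize [] zero = [] ∷ []
subsetsOfSize [] (suc k) = []
subsetsOfSize (false ∷ U) k = map (false ∷_) (subsetsOfSize U k)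
subsetsOfSize (true ∷ U) zero = map (false ∷_) (subsetsOfSize U zero)
subsetsOfSize (true ∷ U) (suc k) = map (false ∷_) (subsetsOfSize U (suc k)) ++ map (true ∷_) (subsetsOfSize U k)

length-subsetsOfSize : ∀ {n} (U : Subset n) k → length (subsetsOfSize U k) ≡ ∣ U ∣ C k
length-subsetsOfSize [] zero = refl
length-subsetsOfSize [] (suc k) = refl
length-subsetsOfSize (false ∷ U) k =
  trans (length-map (false ∷_) (subsetsOfSize U k)) (length-subsetsOfSize U k)
length-subsetsOfSize (true ∷ U) zero =
  trans (length-map (false ∷_) (subsetsOfSize U zero)) (length-subsetsOfSize U zero)
length-subsetsOfSize (true ∷ U) (suc k) = begin
  length (map (false ∷_) (subsetsOfSize U (suc k)) ++ map (true ∷_) (subsetsOfSize U k))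
    ≡⟨ length-++ (map (false ∷_) (subsetsOfSize U (suc k))) ⟩
  length (map (false ∷_) (subsetsOfSize U (suc k))) + length (map (true ∷_) (subsetsOfSize U k))
    ≡⟨ cong₂ _+_ (length-map (false ∷_) (subsetsOfSize U (suc k))) (length-map (true ∷_) (subsetsOfSize U k)) ⟩
  length (subsetsOfSize U (suc k)) + length (subsetsOfSize U k)
    ≡⟨ cong₂ _+_ (length-subsetsOfSize U (suc k)) (length-subsetsOfSize U k) ⟩
  ∣ U ∣ C suc k + ∣ U ∣ C k
    ≡⟨ pascal ∣ U ∣ k ⟩
  suc ∣ U ∣ C suc k
    ∎
  where open ≡-Reasoning

∈-subsetsOfSize : ∀ {n} {A U : Subset n} → A ⊆ˢ U → A ∈ subsetsOfSize U ∣ A ∣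
∈-subsetsOfSize {A = []} {[]} _ = here refl
∈-subsetsOfSize {A = false ∷ A} {false ∷ U} A⊆U = ∈-map⁺ (false ∷_) (∈-subsetsOfSize (drop-∷-⊆ A⊆U))
∈-subsetsOfSize {A = true ∷ A} {false ∷ U} A⊆U with () ← A⊆U Vec.here
∈-subsetsOfSize {A = false ∷ A} {true ∷ U} A⊆U with ∣ A ∣ | ∈-subsetsOfSize (drop-∷-⊆ A⊆U)
... | zero | A∈ = ∈-map⁺ (false ∷_) A∈
... | suc k | A∈ = ∈-++⁺ˡ (∈-map⁺ (false ∷_) A∈)
∈-subsetsOfSize {A = true ∷ A} {true ∷ U} A⊆U =
  ∈-++⁺ʳ (map (false ∷_) (subsetsOfSize U (suc ∣ A ∣)))
         (∈-map⁺ (true ∷_) (∈-subsetsOfSize (drop-∷-⊆ A⊆U)))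

⊆-⋃ : ∀ {n} {A : Subset n} {X} → A ∈ X → A ⊆ˢ ⋃ X
⊆-⋃ {X = A ∷ X} (here refl) = p⊆p∪q (⋃ X)
⊆-⋃ {X = B ∷ X} (there A∈X) = ⊆-trans (⊆-⋃ A∈X) (q⊆p∪q B (⋃ X))

⋃-disjoint : ∀ {n} (X : List (Subset n)) {W} → (∀ {A} → A ∈ X → A ∩ W ≡ ⊥) → ⋃ X ∩ W ≡ ⊥
⋃-disjoint [] {W} _ = ∩-zeroˡ W
⋃-disjoint (A ∷ X) {W} disj = begin
  (A ∪ ⋃ X) ∩ W         ≡⟨ ∩-distribʳ-∪ W A (⋃ X) ⟩
  (A ∩ W) ∪ (⋃ X ∩ W)   ≡⟨ cong₂ _∪_ (disj (here refl)) (⋃-disjoint X (disj ∘ there)) ⟩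
  ⊥ ∪ ⊥                 ≡⟨ ∪-identityˡ ⊥ ⟩
  ⊥                     ∎
  where open ≡-Reasoning

⋃-disjoint₂ : ∀ {n} (X Y : List (Subset n)) → (∀ {A B} → A ∈ X → B ∈ Y → A ∩ B ≡ ⊥) →
  ⋃ X ∩ ⋃ Y ≡ ⊥
⋃-disjoint₂ X Y disj = ⋃-disjoint X λ A∈X →
  trans (∩-comm _ (⋃ Y)) (⋃-disjoint Y λ B∈Y → trans (∩-comm _ _) (disj A∈X B∈Y))

disjoint⇒∣p∣+∣q∣≤n : ∀ {n} {p q : Subset n} → p ∩ q ≡ ⊥ → ∣ p ∣ + ∣ q ∣ ≤ n
disjoint⇒∣p∣+∣q∣≤n {n} {p} {q} p∩q≡⊥ = begin
  ∣ p ∣ + ∣ q ∣         ≤⟨ +-monoʳ-≤ ∣ p ∣ (p⊆q⇒∣p∣≤∣q∣ q⊆∁p) ⟩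
  ∣ p ∣ + ∣ ∁ p ∣       ≡⟨ cong (∣ p ∣ +_) (∣∁p∣≡n∸∣p∣ p) ⟩
  ∣ p ∣ + (n ∸ ∣ p ∣)   ≡⟨ m+[n∸m]≡n (∣p∣≤n p) ⟩
  n                     ∎
  where
  open ≤-Reasoning
  q⊆∁p : q ⊆ˢ ∁ p
  q⊆∁p x∈q = x∉p⇒x∈∁p λ x∈p → ∉⊥ (subst (_ ∈ˢ_) p∩q≡⊥ (x∈p∩q⁺ (x∈p , x∈q)))

length-RowSet≤ : ∀ {d k} (X : RowSet d k) → length (proj₁ X) ≤ ∣ ⋃ (proj₁ X) ∣ C k
length-RowSet≤ {k = k} (X , !X , ∣X∣≡k) = begin
  length X                        ≤⟨ Unique-⊆⇒length≤ !X X⊆ ⟩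
  length (subsetsOfSize (⋃ X) k)  ≡⟨ length-subsetsOfSize (⋃ X) k ⟩
  ∣ ⋃ X ∣ C k                     ∎
  where
  open ≤-Reasoning
  X⊆ : X ⊆ subsetsOfSize (⋃ X) k
  X⊆ A∈X =
    subst (λ i → _ ∈ subsetsOfSize (⋃ X) i) (All.lookup ∣X∣≡k A∈X) (∈-subsetsOfSize (⊆-⋃ A∈X))

Pair : ℕ → Set
Pair d = Subset d × Subset d

consPair : ∀ {d} → Bool → Bool → Pair d → Pair (suc d)
consPair x y (A , B) = x ∷ A , y ∷ B

consPair-injective : ∀ {d x y} {e e′ : Pair d} → consPair x y e ≡ consPair x y e′ → e ≡ e′
consPair-injective {e = A , B} {A′ , B′} refl = refl

heads : ∀ {d} → Pair (suc d) → Bool × Bool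
heads (x ∷ _ , y ∷ _) = x , y

heads-∈-map-consPair : ∀ {d x y} {L : List (Pair d)} {e} → e ∈ map (consPair x y) L → heads e ≡ (x , y)
heads-∈-map-consPair e∈ with ∈-map⁻ (consPair _ _) e∈
... | _ , _ , refl = refl

-- The pairs are split by where the first point of [suc d] lies: in neither set, in A, or in B.
mutual
  disjointPairs : (d a b : ℕ) → List (Pair d)
  disjointPairs zero zero zero = ([] , []) ∷ []
  disjointPairs zero (suc a) b = []
  disjointPairs zero zero (suc b) = []
  disjointPairs (suc d) a b =
    map (consPair false false) (disjointPairs d a b) ++ (disjointPairsᴬ d a b ++ disjointPairsᴮ d a b)

  disjointPairsᴬ : (d a b : ℕ) → List (Pair (suc d))
  disjointPairsᴬ d zero b = []
  disjointPairsᴬ d (suc a) b = map (consPair true false) (disjointPairs d a b)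

  disjointPairsᴮ : (d a b : ℕ) → List (Pair (suc d))
  disjointPairsᴮ d a zero = []
  disjointPairsᴮ d a (suc b) = map (consPair false true) (disjointPairs d a b)

∈-disjointPairs⁻ : ∀ d a b {A B} → (A , B) ∈ disjointPairs d a b →
  ∣ A ∣ ≡ a × ∣ B ∣ ≡ b × A ∩ B ≡ ⊥
∈-disjointPairs⁻ zero zero zero (here refl) = refl , refl , refl
∈-disjointPairs⁻ (suc d) a b e∈ with ∈-++⁻ (map (consPair false false) (disjointPairs d a b)) e∈
... | inj₁ e∈₀ with ∈-map⁻ (consPair false false) e∈₀
...   | _ , e∈′ , refl with ∈-disjointPairs⁻ d a b e∈′
...     | ∣A∣ , ∣B∣ , A∩B = ∣A∣ , ∣B∣ , cong (false ∷_) A∩B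
∈-disjointPairs⁻ (suc d) a b e∈ | inj₂ e∈₁ with ∈-++⁻ (disjointPairsᴬ d a b) e∈₁
∈-disjointPairs⁻ (suc d) (suc a) b e∈ | inj₂ e∈₁ | inj₁ e∈ᴬ with ∈-map⁻ (consPair true false) e∈ᴬ
...   | _ , e∈′ , refl with ∈-disjointPairs⁻ d a b e∈′
...     | ∣A∣ , ∣B∣ , A∩B = cong suc ∣A∣ , ∣B∣ , cong (false ∷_) A∩B
∈-disjointPairs⁻ (suc d) a (suc b) e∈ | inj₂ e∈₁ | inj₂ e∈ᴮ with ∈-map⁻ (consPair false true) e∈ᴮ
...   | _ , e∈′ , refl with ∈-disjointPairs⁻ d a b e∈′
...     | ∣A∣ , ∣B∣ , A∩B = ∣A∣ , cong suc ∣B∣ , cong (false ∷_) A∩B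

heads-disjointPairsᴬ : ∀ d a b {e} → e ∈ disjointPairsᴬ d a b → heads e ≡ (true , false)
heads-disjointPairsᴬ d (suc a) b = heads-∈-map-consPair

heads-disjointPairsᴮ : ∀ d a b {e} → e ∈ disjointPairsᴮ d a b → heads e ≡ (false , true)
heads-disjointPairsᴮ d a (suc b) = heads-∈-map-consPair

mutual
  Unique-disjointPairs : ∀ d a b → Unique (disjointPairs d a b)
  Unique-disjointPairs zero zero zero = [] ∷ []
  Unique-disjointPairs zero (suc a) b = []
  Unique-disjointPairs zero zero (suc b) = []
  Unique-disjointPairs (suc d) a b =
    ++⁺ (map⁺ consPair-injective (Unique-disjointPairs d a b))
        (++⁺ (Unique-disjointPairsᴬ d a b) (Unique-disjointPairsᴮ d a b) ᴬ#ᴮ) ₀#ᴬᴮ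
    where
    ᴬ#ᴮ : Disjoint (disjointPairsᴬ d a b) (disjointPairsᴮ d a b)
    ᴬ#ᴮ (eᴬ , eᴮ) with () ← trans (sym (heads-disjointPairsᴬ d a b eᴬ)) (heads-disjointPairsᴮ d a b eᴮ)
    ₀#ᴬᴮ : Disjoint (map (consPair false false) (disjointPairs d a b))
                    (disjointPairsᴬ d a b ++ disjointPairsᴮ d a b)
    ₀#ᴬᴮ (e₀ , e₁) with ∈-++⁻ (disjointPairsᴬ d a b) e₁
    ... | inj₁ eᴬ with () ← trans (sym (heads-∈-map-consPair e₀)) (heads-disjointPairsᴬ d a b eᴬ)
    ... | inj₂ eᴮ with () ← trans (sym (heads-∈-map-consPair e₀)) (heads-disjointPairsᴮ d a b eᴮ)

  Unique-disjointPairsᴬ : ∀ d a b → Unique (disjointPairsᴬ d a b)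
  Unique-disjointPairsᴬ d zero b = []
  Unique-disjointPairsᴬ d (suc a) b = map⁺ consPair-injective (Unique-disjointPairs d a b)

  Unique-disjointPairsᴮ : ∀ d a b → Unique (disjointPairsᴮ d a b)
  Unique-disjointPairsᴮ d a zero = []
  Unique-disjointPairsᴮ d a (suc b) = map⁺ consPair-injective (Unique-disjointPairs d a b)

length-disjointPairs-suc : ∀ d a b → length (disjointPairs (suc d) a b) ≡
  length (disjointPairs d a b) + (length (disjointPairsᴬ d a b) + length (disjointPairsᴮ d a b))
length-disjointPairs-suc d a b = trans (length-++ (map (consPair false false) (disjointPairs d a b)))
  (cong₂ _+_ (length-map (consPair false false) (disjointPairs d a b)) (length-++ (disjointPairsᴬ d a b)))

pairCount : ℕ → ℕ → ℕ → ℕ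
pairCount d a b = (d C (a + b)) * ((a + b) C a)

pairCount-zeroˡ : ∀ d b → pairCount d 0 b ≡ d C b
pairCount-zeroˡ d b = *-identityʳ (d C b)

pairCount-zeroʳ : ∀ d a → pairCount d a 0 ≡ d C a
pairCount-zeroʳ d a rewrite +-identityʳ a | nCn≡1 a = *-identityʳ (d C a)

pairCount-sucˡ : ∀ d a → pairCount d (suc a) 0 + pairCount d a 0 ≡ pairCount (suc d) (suc a) 0
pairCount-sucˡ d a = begin
  pairCount d (suc a) 0 + pairCount d a 0  ≡⟨ cong₂ _+_ (pairCount-zeroʳ d (suc a)) (pairCount-zeroʳ d a) ⟩
  d C suc a + d C a                        ≡⟨ pascal d a ⟩
  suc d C suc a                            ≡⟨ sym (pairCount-zeroʳ (suc d) (suc a)) ⟩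
  pairCount (suc d) (suc a) 0              ∎
  where open ≡-Reasoning

pairCount-sucʳ : ∀ d b → pairCount d 0 (suc b) + pairCount d 0 b ≡ pairCount (suc d) 0 (suc b)
pairCount-sucʳ d b = begin
  pairCount d 0 (suc b) + pairCount d 0 b  ≡⟨ cong₂ _+_ (pairCount-zeroˡ d (suc b)) (pairCount-zeroˡ d b) ⟩
  d C suc b + d C b                        ≡⟨ pascal d b ⟩
  suc d C suc b                            ≡⟨ sym (pairCount-zeroˡ (suc d) (suc b)) ⟩
  pairCount (suc d) 0 (suc b)              ∎
  where open ≡-Reasoning

pairCount-suc : ∀ d a b →
  pairCount d (suc a) (suc b) + (pairCount d a (suc b) + pairCount d (suc a) b) ≡ pairCount (suc d) (suc a) (suc b)
pairCount-suc d a b = begin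
  pairCount d (suc a) (suc b) + (pairCount d a (suc b) + pairCount d (suc a) b)
    ≡⟨ cong (λ t → (d C suc t) * (suc t C suc a) + ((d C t) * (t C a) + q * x)) (+-suc a b) ⟩
  (d C (2 + s)) * ((2 + s) C suc a) + (q * y + q * x)
    ≡⟨ cong (λ t → (d C (2 + s)) * t + (q * y + q * x)) (sym (pascal (suc s) a)) ⟩
  (d C (2 + s)) * (x + y) + (q * y + q * x)
    ≡⟨ expand (d C (2 + s)) q x y ⟩
  (d C (2 + s) + q) * (x + y)
    ≡⟨ cong₂ _*_ (pascal d (suc s)) (pascal (suc s) a) ⟩
  (suc d C (2 + s)) * ((2 + s) C suc a)
    ≡⟨ cong (λ t → (suc d C suc t) * (suc t C suc a)) (sym (+-suc a b)) ⟩
  pairCount (suc d) (suc a) (suc b)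
    ∎
  where
  open ≡-Reasoning
  s = a + b
  q = d C (1 + s)
  x = (1 + s) C suc a
  y = (1 + s) C a
  expand : ∀ p q x y → p * (x + y) + (q * y + q * x) ≡ (p + q) * (x + y)
  expand = solve-∀

mutual
  length-disjointPairs : ∀ d a b → length (disjointPairs d a b) ≡ pairCount d a b
  length-disjointPairs zero zero zero = refl
  length-disjointPairs zero (suc a) b = refl
  length-disjointPairs zero zero (suc b) = sym (pairCount-zeroˡ 0 (suc b))
  length-disjointPairs (suc d) zero zero =
    trans (length-disjointPairs-suc d 0 0) (trans (+-identityʳ _) (length-disjointPairs d 0 0))
  length-disjointPairs (suc d) (suc a) zero = begin
    length (disjointPairs (suc d) (suc a) 0)
      ≡⟨ length-disjointPairs-suc d (suc a) 0 ⟩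
    length (disjointPairs d (suc a) 0) + (length (disjointPairsᴬ d (suc a) 0) + 0)
      ≡⟨ cong₂ _+_ (length-disjointPairs d (suc a) 0) (trans (+-identityʳ _) (length-disjointPairsᴬ d a 0)) ⟩
    pairCount d (suc a) 0 + pairCount d a 0
      ≡⟨ pairCount-sucˡ d a ⟩
    pairCount (suc d) (suc a) 0
      ∎
    where open ≡-Reasoning
  length-disjointPairs (suc d) zero (suc b) = begin
    length (disjointPairs (suc d) 0 (suc b))
      ≡⟨ length-disjointPairs-suc d 0 (suc b) ⟩
    length (disjointPairs d 0 (suc b)) + length (disjointPairsᴮ d 0 (suc b))
      ≡⟨ cong₂ _+_ (length-disjointPairs d 0 (suc b)) (length-disjointPairsᴮ d 0 b) ⟩
    pairCount d 0 (suc b) + pairCount d 0 b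
      ≡⟨ pairCount-sucʳ d b ⟩
    pairCount (suc d) 0 (suc b)
      ∎
    where open ≡-Reasoning
  length-disjointPairs (suc d) (suc a) (suc b) = begin
    length (disjointPairs (suc d) (suc a) (suc b))
      ≡⟨ length-disjointPairs-suc d (suc a) (suc b) ⟩
    length (disjointPairs d (suc a) (suc b))
      + (length (disjointPairsᴬ d (suc a) (suc b)) + length (disjointPairsᴮ d (suc a) (suc b)))
      ≡⟨ cong₂ _+_ (length-disjointPairs d (suc a) (suc b))
                   (cong₂ _+_ (length-disjointPairsᴬ d a (suc b)) (length-disjointPairsᴮ d (suc a) b)) ⟩
    pairCount d (suc a) (suc b) + (pairCount d a (suc b) + pairCount d (suc a) b)
      ≡⟨ pairCount-suc d a b ⟩
    pairCount (suc d) (suc a) (suc b)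
      ∎
    where open ≡-Reasoning

  length-disjointPairsᴬ : ∀ d a b → length (disjointPairsᴬ d (suc a) b) ≡ pairCount d a b
  length-disjointPairsᴬ d a b =
    trans (length-map (consPair true false) (disjointPairs d a b)) (length-disjointPairs d a b)

  length-disjointPairsᴮ : ∀ d a b → length (disjointPairsᴮ d a (suc b)) ≡ pairCount d a b
  length-disjointPairsᴮ d a b =
    trans (length-map (consPair false true) (disjointPairs d a b)) (length-disjointPairs d a b)

AllOnes : ∀ {d p q} → Rect d p q → Set
AllOnes R = ∀ {A B} → A ∈ rows R → B ∈ cols R → DisjOne A B

totalSize-∷ : ∀ {d p q} (R : Rect d p q) (Rs : List (Rect d p q)) →
  totalSize (R ∷ Rs) ≡ (length (rows R) + length (cols R)) + totalSize Rs
totalSize-∷ R Rs =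
  swap-middle (length (rows R)) (length (cols R)) (sum (map (length ∘ rows) Rs)) (sum (map (length ∘ cols) Rs))
  where
  swap-middle : ∀ a b c e → (a + c) + (b + e) ≡ (a + b) + (c + e)
  swap-middle = solve-∀

oneEntries : ∀ {d p q} (Rs : List (Rect d p q)) → All Monochromatic Rs → List (Pair d)
oneEntries [] [] = []
oneEntries (R ∷ Rs) (inj₁ _ ∷ mono) = cartesianProduct (rows R) (cols R) ++ oneEntries Rs mono
oneEntries (R ∷ Rs) (inj₂ _ ∷ mono) = oneEntries Rs mono

∈-oneEntries : ∀ {d p q} (Rs : List (Rect d p q)) mono {A B} → DisjOne A B →
  Any (λ R → A ∈ rows R × B ∈ cols R) Rs → (A , B) ∈ oneEntries Rs mono
∈-oneEntries (R ∷ Rs) (inj₁ _ ∷ mono) _ (here (A∈X , B∈Y)) = ∈-++⁺ˡ (∈-cartesianProduct⁺ A∈X B∈Y)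
∈-oneEntries (R ∷ Rs) (inj₂ allZeros ∷ mono) A∩B≡⊥ (here (A∈X , B∈Y)) =
  contradiction A∩B≡⊥ (allZeros A∈X B∈Y)
∈-oneEntries (R ∷ Rs) (inj₁ _ ∷ mono) A∩B≡⊥ (there AB∈) =
  ∈-++⁺ʳ (cartesianProduct (rows R) (cols R)) (∈-oneEntries Rs mono A∩B≡⊥ AB∈)
∈-oneEntries (R ∷ Rs) (inj₂ _ ∷ mono) A∩B≡⊥ (there AB∈) = ∈-oneEntries Rs mono A∩B≡⊥ AB∈

module _ {d k n : ℕ} (d≤n+n : d ≤ n + n) where

  area-oneRect≤ : (R : Rect d k k) → AllOnes R →
    length (rows R) * length (cols R) ≤ (n C k) * (length (rows R) + length (cols R))
  area-oneRect≤ R@(X , Y) allOnes = m≤o⊎n≤o⇒m*n≤o*[m+n] (Sum.map (side X) (side Y) small)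
    where
    side : (Z : RowSet d k) → ∣ ⋃ (proj₁ Z) ∣ ≤ n → length (proj₁ Z) ≤ n C k
    side Z ∣⋃Z∣≤n = ≤-trans (length-RowSet≤ Z) (C-monoˡ-≤ k ∣⋃Z∣≤n)
    small : ∣ ⋃ (rows R) ∣ ≤ n ⊎ ∣ ⋃ (cols R) ∣ ≤ n
    small = m+n≤o+o⇒m≤o⊎n≤o
      (≤-trans (disjoint⇒∣p∣+∣q∣≤n (⋃-disjoint₂ (rows R) (cols R) allOnes)) d≤n+n)

  length-oneEntries≤ : ∀ Rs mono → length (oneEntries Rs mono) ≤ (n C k) * totalSize Rs
  length-oneEntries≤ [] [] = z≤n
  length-oneEntries≤ (R ∷ Rs) (inj₁ allOnes ∷ mono) = begin
    length (cartesianProduct (rows R) (cols R) ++ oneEntries Rs mono)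
      ≡⟨ length-++ (cartesianProduct (rows R) (cols R)) ⟩
    length (cartesianProduct (rows R) (cols R)) + length (oneEntries Rs mono)
      ≡⟨ cong (_+ length (oneEntries Rs mono)) (length-cartesianProduct (rows R) (cols R)) ⟩
    length (rows R) * length (cols R) + length (oneEntries Rs mono)
      ≤⟨ +-mono-≤ (area-oneRect≤ R allOnes) (length-oneEntries≤ Rs mono) ⟩
    (n C k) * (length (rows R) + length (cols R)) + (n C k) * totalSize Rs
      ≡⟨ sym (*-distribˡ-+ (n C k) _ (totalSize Rs)) ⟩
    (n C k) * ((length (rows R) + length (cols R)) + totalSize Rs)
      ≡⟨ cong ((n C k) *_) (sym (totalSize-∷ R Rs)) ⟩
    (n C k) * totalSize (R ∷ Rs)
      ∎
    where open ≤-Reasoning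
  length-oneEntries≤ (R ∷ Rs) (inj₂ _ ∷ mono) = begin
    length (oneEntries Rs mono)  ≤⟨ length-oneEntries≤ Rs mono ⟩
    (n C k) * totalSize Rs       ≤⟨ *-monoʳ-≤ (n C k) (m≤n+m (totalSize Rs) (length (rows R) + length (cols R))) ⟩
    (n C k) * ((length (rows R) + length (cols R)) + totalSize Rs)
                                 ≡⟨ cong ((n C k) *_) (sym (totalSize-∷ R Rs)) ⟩
    (n C k) * totalSize (R ∷ Rs) ∎
    where open ≤-Reasoning

  pairCount≤ : ∀ Rs → IsOneCover d k k Rs → pairCount d k k ≤ (n C k) * totalSize Rs
  pairCount≤ Rs (mono , covers) = begin
    pairCount d k k                     ≡⟨ sym (length-disjointPairs d k k) ⟩
    length (disjointPairs d k k)        ≤⟨ Unique-⊆⇒length≤ (Unique-disjointPairs d k k) covered ⟩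
    length (oneEntries Rs mono)         ≤⟨ length-oneEntries≤ Rs mono ⟩
    (n C k) * totalSize Rs              ∎
    where
    open ≤-Reasoning
    covered : disjointPairs d k k ⊆ oneEntries Rs mono
    covered {A , B} AB∈ with ∈-disjointPairs⁻ d k k AB∈
    ... | ∣A∣≡k , ∣B∣≡k , A∩B≡⊥ = ∈-oneEntries Rs mono A∩B≡⊥ (covers A B ∣A∣≡k ∣B∣≡k A∩B≡⊥)

cover-bound : ∀ k → .{{_ : NonZero k}} → (Rs : List (Rect (4 * k) k k)) → IsOneCover (4 * k) k k Rs →
  2 ^ (4 * k) ≤ 4 * k * totalSize Rs
cover-bound k@(suc j) Rs cover =
  *-cancelʳ-≤ (2 ^ d) (d * totalSize Rs) (n C k) ⦃ >-nonZero (0<C (m≤m+n k k)) ⦄ (begin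
  2 ^ d * (n C k)               ≤⟨ *-monoˡ-≤ (n C k) central ⟩
  d * (d C n) * (n C k)         ≡⟨ *-assoc d (d C n) (n C k) ⟩
  d * pairCount d k k           ≤⟨ *-monoʳ-≤ d (pairCount≤ {n = n} (≤-reflexive d≡n+n) Rs cover) ⟩
  d * ((n C k) * totalSize Rs)  ≡⟨ reassoc d (n C k) (totalSize Rs) ⟩
  d * totalSize Rs * (n C k)    ∎)
  where
  open ≤-Reasoning
  n = k + k
  d = 4 * k
  d≡n+n : d ≡ n + n
  d≡n+n = 4*k≡[k+k]+[k+k] k
    where
    4*k≡[k+k]+[k+k] : ∀ k → 4 * k ≡ (k + k) + (k + k)
    4*k≡[k+k]+[k+k] = solve-∀
  central : 2 ^ d ≤ d * (d C n)
  central = subst (λ e → 2 ^ e ≤ e * (e C n)) (sym d≡n+n) (central-C-bound (j + k))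
  reassoc : ∀ a b c → a * (b * c) ≡ a * c * b
  reassoc = solve-∀

theorem6 : Σ ℕ λ C → ∀ (k : ℕ) → .{{_ : NonZero k}} →
    (Rs : List (Rect (4 * k) k k)) → IsOneCover (4 * k) k k Rs →
    2 ^ (4 * k) ≤ (4 * k) ^ C * totalSize Rs
theorem6 = 1 , λ k Rs cover →
  subst (λ c → 2 ^ (4 * k) ≤ c * totalSize Rs) (sym (*-identityʳ (4 * k))) (cover-bound k Rs cover)
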